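{- Let $k$ be an integer and let $G$ be a non-complete double-critical $k$-chromatic graph. For every edge $xy\in E(G)$, every $(k-2)$-colouring of $G-x-y$ with colour set $\{1,\dots,k-2\}$, and every non-empty sequence $j_1,j_2,\dots,j_i$ of $i$ distinct colours from $\{1,\dots,k-2\}$, there is a path on $i+2$ vertices starting at $x$ and ending at $y$ such that, for every $t\in\{1,\dots,i\}$, the $t$-th vertex after $x$ has colour $j_t$. In particular, $xy$ is contained in at least $(k-2)!/(k-2-i)!$ cycles of length $i+2$.
   Context: All graphs are finite and simple. A graph $G$ is (vertex-)critical if $\chi(G-v)<\chi(G)$ for every vertex $v$. A critical graph $G$ is double-critical if $\chi(G-x-y)\le \chi(G)-2$ for every edge $xy\in E(G)$ (here $G-x-y$ denotes deletion of both end-vertices). The length of a cycle is its number of edges. -}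

module Defs where

open import Data.Nat using (ℕ; zero; suc; _≤_; _<_; _∸_)
open import Data.Fin using (Fin; zero; suc; inject₁; fromℕ)
open import Data.Vec using (Vec; lookup)
open import Data.Bool using (Bool; T)
open import Data.Product using (Σ; ∃; ∃-syntax; _×_)
open import Relation.Nullary using (¬_)
open import Relation.Binary.PropositionalEquality using (_≡_; _≢_)
open import Function.Definitions using (Injective)

record Graph (n : ℕ) : Set where
  field
    adj   : Fin n → Fin n → Bool
    sym   : ∀ u v → adj u v ≡ adj v u
    irrefl : ∀ v → adj v v ≡ Data.Bool.false

open Graph public

Adj : ∀ {n} → Graph n → Fin n → Fin n → Set
Adj G u v = T (adj G u v)

-- A vertex subset (as a predicate) determines an induced subgraph G[P].
VSet : ℕ → Set₁
VSet n = Fin n → Set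

All′ : ∀ {n} → VSet n
All′ _ = Data.Unit.⊤
  where import Data.Unit

Minus1 : ∀ {n} → Fin n → VSet n
Minus1 v u = u ≢ v

Minus2 : ∀ {n} → Fin n → Fin n → VSet n
Minus2 x y u = (u ≢ x) × (u ≢ y)

Colouring : ∀ {n} → VSet n → ℕ → Set
Colouring {n} P c = (v : Fin n) → P v → Fin c

Proper : ∀ {n} (G : Graph n) (P : VSet n) {c} → Colouring P c → Set
Proper {n} G P f =
  ∀ (u v : Fin n) (pu : P u) (pv : P v) → Adj G u v → f u pu ≢ f v pv

Colourable : ∀ {n} → Graph n → VSet n → ℕ → Set
Colourable G P c = Σ (Colouring P c) (Proper G P)

ChromaticNumber : ∀ {n} → Graph n → VSet n → ℕ → Set
ChromaticNumber G P k = Colourable G P k × (∀ c → c < k → ¬ Colourable G P c)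

ChiLess : ∀ {n} → Graph n → VSet n → ℕ → Set
ChiLess G P k = ∃[ c ] (c < k × Colourable G P c)

ChiAtMost : ∀ {n} → Graph n → VSet n → ℕ → Set
ChiAtMost G P m = ∃[ c ] (c ≤ m × Colourable G P c)

KChromatic : ∀ {n} → Graph n → ℕ → Set
KChromatic G k = ChromaticNumber G All′ k

Critical : ∀ {n} → Graph n → ℕ → Set
Critical {n} G k = ∀ (v : Fin n) → ChiLess G (Minus1 v) k

DoubleCritical : ∀ {n} → Graph n → ℕ → Set
DoubleCritical {n} G k =
  Critical G k ×
  (∀ (x y : Fin n) → Adj G x y → ChiAtMost G (Minus2 x y) (k ∸ 2))

Complete : ∀ {n} → Graph n → Set
Complete {n} G = ∀ (u v : Fin n) → u ≢ v → Adj G u v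

IsXYPath : ∀ {n} → Graph n → Fin n → Fin n → (i : ℕ) → Vec (Fin n) (suc (suc i)) → Set
IsXYPath G x y i p =
  Injective _≡_ _≡_ (lookup p) ×
  lookup p zero ≡ x ×
  lookup p (fromℕ (suc i)) ≡ y ×
  (∀ (t : Fin (suc i)) → Adj G (lookup p (inject₁ t)) (lookup p (suc t)))

-- The t-th vertex after x (t = 1 … i, here indexed by t : Fin i) has colour js t.
ColouredAs : ∀ {n c} {P : VSet n} (f : Colouring P c) (i : ℕ) →
             Vec (Fin n) (suc (suc i)) → (Fin i → Fin c) → Set
ColouredAs {P = P} f i p js =
  ∀ (t : Fin i) → Σ (P (lookup p (suc (inject₁ t))))
                     (λ pr → f (lookup p (suc (inject₁ t))) pr ≡ js t)

{-# OPTIONS --safe #-}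
module Submission where

-- Fix an edge xy and a proper (k-2)-colouring of G - x - y, and an injective colour
-- sequence c₀ … c_r.  Call v ∈ G - x - y a layer-t vertex if v has colour c_t and
-- continues to y along a walk v_{t+1} … v_r y whose vertices have the colours
-- c_{t+1} … c_r.  If x has a neighbour in layer 0, such a walk from x is the required
-- path (it is a path because its inner vertices carry distinct colours).  Otherwise
-- recolour: x gets a new colour, every layer-t vertex gets c_{t-1} (layer 0 the new
-- colour) and y gets c_r.  Whenever a vertex v of colour c_{t-1} is adjacent to a
-- layer-t vertex, v is itself in layer t-1, so this is a proper (k-1)-colouring of G,
-- contradicting χ(G) = k.  Distinct colour sequences give distinct paths, and there
-- are (k-2)!/(k-2-i)! injective sequences of length i.

open import Defs hiding (sym)
open import Data.Nat using (ℕ; zero; suc; _≤_; _∸_; _+_; _*_; z≤n; _≤ᵇ_)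
open import Data.Nat.Properties using (≤-refl; 0∸n≡0; module ≤-Reasoning)
open import Data.Nat.Combinatorics using (_P_)
open import Data.Nat.Combinatorics.Base using (_P′_)
open import Data.Nat.Combinatorics.Specification using (nP′k≡n[n∸1P′k∸1])
open import Data.Fin using (Fin; zero; suc; fromℕ; inject₁; inject≤; punchIn; _≟_)
open import Data.Fin.Properties
  using (any?; 0≢1+n; suc-injective; fromℕ≢inject₁; inject₁-injective; inject≤-injective;
         punchIn-injective; punchInᵢ≢i)
open import Data.Vec using (Vec; []; _∷_; lookup; tabulate)
import Data.Vec as Vec
open import Data.Vec.Properties using (∷-injective; lookup-map; tabulate∘lookup; tabulate-cong)
open import Data.Vec.Functional using (head; tail)
open import Data.List using (List; []; _∷_; _++_; length; map; allFin; cartesianProductWith)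
open import Data.List.Properties using (length-++; length-map; length-tabulate)
open import Data.List.Relation.Unary.All using (All; []; _∷_; toList; universal)
import Data.List.Relation.Unary.All as All
import Data.List.Relation.Unary.All.Properties as All
open import Data.List.Relation.Unary.AllPairs using ([]; _∷_)
import Data.List.Relation.Unary.AllPairs as AllPairs
import Data.List.Relation.Unary.AllPairs.Properties as AllPairs
open import Data.List.Relation.Unary.Unique.Propositional using (Unique)
import Data.List.Relation.Unary.Unique.Propositional.Properties as Unique
open import Data.Bool using (true; false; T; T?)
open import Data.Product using (Σ; ∃; _×_; _,_; proj₁; proj₂)
open import Function using (_∘_; id)
open import Function.Definitions using (Injective)
open import Relation.Nullary using (¬_; Dec; yes; no; ¬?; contradiction)
open import Relation.Nullary.Decidable using (_×-dec_; map′)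
open import Relation.Unary using (Decidable)
open import Relation.Binary.PropositionalEquality
  using (_≡_; _≢_; refl; sym; trans; cong; cong₂; subst; setoid; module ≡-Reasoning)

module _ {n : ℕ} (G : Graph n) where

  Adj-sym : ∀ {u v} → Adj G u v → Adj G v u
  Adj-sym {u} {v} = subst T (Graph.sym G u v)

  Adj-irrefl : ∀ {v} → ¬ Adj G v v
  Adj-irrefl {v} = subst T (irrefl G v)

  Adj⇒≢ : ∀ {u v} → Adj G u v → u ≢ v
  Adj⇒≢ uv refl = Adj-irrefl uv

Minus2? : ∀ {n} (x y : Fin n) → Decidable (Minus2 x y)
Minus2? x y v = ¬? (v ≟ x) ×-dec ¬? (v ≟ y)

KChromatic⇒¬Colourable[1+k∸2] : ∀ {n} {G : Graph n} {k} →
  KChromatic G k → Fin (k ∸ 2) → ¬ Colourable G All′ (suc (k ∸ 2))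
KChromatic⇒¬Colourable[1+k∸2] {k = suc (suc _)} (_ , minimal) _ = minimal _ ≤-refl

-- Colourings of induced subgraphs

module _ {n : ℕ} {S : VSet n} {c : ℕ} where

  HasColour : Colouring S c → Fin n → Fin c → Set
  HasColour f v a = Σ (S v) (λ p → f v p ≡ a)

  -- A colouring may, a priori, depend on the proof that v lies in S.
  Irrelevant : Colouring S c → Set
  Irrelevant f = ∀ v (p q : S v) → f v p ≡ f v q

  HasColour-unique : ∀ {f v a b} → Irrelevant f → HasColour f v a → HasColour f v b → a ≡ b
  HasColour-unique {v = v} irr (p , fp≡a) (q , fq≡b) = trans (sym fp≡a) (trans (irr v p q) fq≡b)

  ColouredAs-injective : ∀ {f i p} {js js′ : Fin i → Fin c} → Irrelevant f →
                         ColouredAs f i p js → ColouredAs f i p js′ → ∀ t → js t ≡ js′ t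
  ColouredAs-injective irr coloured coloured′ t = HasColour-unique irr (coloured t) (coloured′ t)

  HasColour-proper : ∀ {G f u v a} → Proper G S f →
                     HasColour f u a → HasColour f v a → ¬ Adj G u v
  HasColour-proper {u = u} {v} proper (p , fu≡a) (q , fv≡a) uv =
    proper u v p q uv (trans fu≡a (sym fv≡a))

ChiAtMost⇒Colourable : ∀ {n} {G : Graph n} {S : VSet n} {d} → ChiAtMost G S d → Colourable G S d
ChiAtMost⇒Colourable (c , c≤d , f , proper) =
    (λ v p → inject≤ (f v p) c≤d)
  , (λ u v p q uv → proper u v p q uv ∘ inject≤-injective c≤d c≤d _ _)

module Canonical {n : ℕ} {S : VSet n} (S? : Decidable S) {c : ℕ} (f : Colouring S c) where

  canonical : Colouring S c
  canonical v p with S? v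
  ... | yes q = f v q
  ... | no ¬q = contradiction p ¬q

  canonical-irrelevant : Irrelevant canonical
  canonical-irrelevant v p q with S? v
  ... | yes _ = refl
  ... | no ¬q = contradiction p ¬q

  canonical-HasColour : ∀ {v a} → HasColour canonical v a → HasColour f v a
  canonical-HasColour {v} (p , e) with S? v
  ... | yes q = q , e
  ... | no ¬q = contradiction p ¬q

  canonical-proper : ∀ {G : Graph n} → Proper G S f → Proper G S canonical
  canonical-proper {G} proper u v p q uv e =
    HasColour-proper {G = G} proper (canonical-HasColour (p , e)) (canonical-HasColour (q , refl)) uv

-- Injective sequences

module _ {A : Set} where

  InjectiveVec : ∀ {k} → Vec A k → Set
  InjectiveVec s = Injective _≡_ _≡_ (lookup s)

  lookup-∷-injective : ∀ {k a} {s : Vec A k} →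
                       (∀ t → a ≢ lookup s t) → InjectiveVec s → InjectiveVec (a ∷ s)
  lookup-∷-injective a∉s s-inj {zero}  {zero}  _ = refl
  lookup-∷-injective a∉s s-inj {zero}  {suc t} e = contradiction e (a∉s t)
  lookup-∷-injective a∉s s-inj {suc t} {zero}  e = contradiction (sym e) (a∉s t)
  lookup-∷-injective a∉s s-inj {suc t} {suc u} e = cong suc (s-inj e)

  Vec-map-injective : ∀ {B : Set} {f : A → B} → Injective _≡_ _≡_ f →
                      ∀ {k} {s t : Vec A k} → Vec.map f s ≡ Vec.map f t → s ≡ t
  Vec-map-injective f-inj {s = []}    {[]}    _ = refl
  Vec-map-injective f-inj {s = a ∷ s} {b ∷ t} e =
    cong₂ _∷_ (f-inj (proj₁ (∷-injective e)))
              (Vec-map-injective f-inj (proj₂ (∷-injective e)))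

  lookup-extensionality : ∀ {k} {s t : Vec A k} → (∀ i → lookup s i ≡ lookup t i) → s ≡ t
  lookup-extensionality {s = s} {t} s≗t = begin
    s                  ≡⟨ tabulate∘lookup s ⟨
    tabulate (lookup s) ≡⟨ tabulate-cong s≗t ⟩
    tabulate (lookup t) ≡⟨ tabulate∘lookup t ⟩
    t                  ∎
    where open ≡-Reasoning

cons-punchIn : ∀ {m k} → Fin (suc m) → Vec (Fin m) k → Vec (Fin (suc m)) (suc k)
cons-punchIn c s = c ∷ Vec.map (punchIn c) s

cons-punchIn-injective : ∀ {m k} {c d : Fin (suc m)} {s t : Vec (Fin m) k} →
                         cons-punchIn c s ≡ cons-punchIn d t → c ≡ d × s ≡ t
cons-punchIn-injective {c = c} e with ∷-injective e
... | refl , e′ = refl , Vec-map-injective (punchIn-injective c _ _) e′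

cons-punchIn-InjectiveVec : ∀ {m k} (c : Fin (suc m)) {s : Vec (Fin m) k} →
                            InjectiveVec s → InjectiveVec (cons-punchIn c s)
cons-punchIn-InjectiveVec c {s} s-inj =
  lookup-∷-injective c∉ (s-inj ∘ punchIn-injective c _ _ ∘ unmap)
  where
  c∉ : ∀ t → c ≢ lookup (Vec.map (punchIn c) s) t
  c∉ t e = punchInᵢ≢i c (lookup s t) (sym (trans e (lookup-map t (punchIn c) s)))

  unmap : ∀ {a b} → lookup (Vec.map (punchIn c) s) a ≡ lookup (Vec.map (punchIn c) s) b →
          punchIn c (lookup s a) ≡ punchIn c (lookup s b)
  unmap {a} {b} e = trans (sym (lookup-map a (punchIn c) s)) (trans e (lookup-map b (punchIn c) s))

arrangements : (m k : ℕ) → List (Vec (Fin m) k)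
arrangements m       zero    = [] ∷ []
arrangements zero    (suc k) = []
arrangements (suc m) (suc k) = cartesianProductWith cons-punchIn (allFin (suc m)) (arrangements m k)

arrangements-injective : ∀ m k → All InjectiveVec (arrangements m k)
arrangements-injective m       zero    = (λ { {()} }) ∷ []
arrangements-injective zero    (suc k) = []
arrangements-injective (suc m) (suc k) =
  All.cartesianProductWith⁺ (setoid _) (setoid _) cons-punchIn (allFin (suc m)) (arrangements m k)
    (λ {c} _ s∈ → cons-punchIn-InjectiveVec c (All.lookup (arrangements-injective m k) s∈))

arrangements-unique : ∀ m k → Unique (arrangements m k)
arrangements-unique m       zero    = [] ∷ []
arrangements-unique zero    (suc k) = []
arrangements-unique (suc m) (suc k) =
  Unique.cartesianProductWith⁺ cons-punchIn cons-punchIn-injective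
    (Unique.allFin⁺ (suc m)) (arrangements-unique m k)

length-cartesianProductWith : ∀ {A B C : Set} (f : A → B → C) xs ys →
  length (cartesianProductWith f xs ys) ≡ length xs * length ys
length-cartesianProductWith f []       ys = refl
length-cartesianProductWith f (x ∷ xs) ys = begin
  length (map (f x) ys ++ cartesianProductWith f xs ys)
    ≡⟨ length-++ (map (f x) ys) ⟩
  length (map (f x) ys) + length (cartesianProductWith f xs ys)
    ≡⟨ cong₂ _+_ (length-map (f x) ys) (length-cartesianProductWith f xs ys) ⟩
  length ys + length xs * length ys
    ∎
  where open ≡-Reasoning

length-arrangements : ∀ m k → length (arrangements m k) ≡ m P′ k
length-arrangements m       zero    = refl
length-arrangements zero    (suc k) = cong (_* (0 P′ k)) (sym (0∸n≡0 k))
length-arrangements (suc m) (suc k) = begin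
  length (cartesianProductWith cons-punchIn (allFin (suc m)) (arrangements m k))
    ≡⟨ length-cartesianProductWith cons-punchIn (allFin (suc m)) (arrangements m k) ⟩
  length (allFin (suc m)) * length (arrangements m k)
    ≡⟨ cong₂ _*_ (length-tabulate {n = suc m} id) (length-arrangements m k) ⟩
  suc m * (m P′ k)
    ≡⟨ nP′k≡n[n∸1P′k∸1] (suc m) (suc k) ⟨
  suc m P′ suc k
    ∎
  where open ≡-Reasoning

-- _P_ is _P′_ with the out-of-range values k > m replaced by 0.
nPk≤nP′k : ∀ m k → m P k ≤ m P′ k
nPk≤nP′k m k with k ≤ᵇ m
... | true  = ≤-refl
... | false = z≤n

module _ {A B : Set} {Q : A → Set} where

  map-proj₁-toList : ∀ {xs} (pxs : All Q xs) → map proj₁ (toList pxs) ≡ xs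
  map-proj₁-toList []         = refl
  map-proj₁-toList (px ∷ pxs) = cong (_ ∷_) (map-proj₁-toList pxs)

  length-map-toList : (g : ∃ Q → B) → ∀ {xs} (pxs : All Q xs) →
                      length (map g (toList pxs)) ≡ length xs
  length-map-toList g {xs} pxs = begin
    length (map g (toList pxs))      ≡⟨ length-map g (toList pxs) ⟩
    length (toList pxs)              ≡⟨ length-map proj₁ (toList pxs) ⟨
    length (map proj₁ (toList pxs))  ≡⟨ cong length (map-proj₁-toList pxs) ⟩
    length xs                        ∎
    where open ≡-Reasoning

  Unique-map-toList : (g : ∃ Q → B) → (∀ {a b} → g a ≡ g b → proj₁ a ≡ proj₁ b) →
                      ∀ {xs} (pxs : All Q xs) → Unique xs → Unique (map g (toList pxs))
  Unique-map-toList g g-inj pxs xs! =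
    AllPairs.map⁺ (AllPairs.map (_∘ g-inj) (AllPairs.map⁻ proj₁-unique))
    where
    proj₁-unique : Unique (map proj₁ (toList pxs))
    proj₁-unique = subst Unique (sym (map-proj₁-toList pxs)) xs!

-- Coloured walks to y and the recolouring argument

module ColouredWalks {n : ℕ} (G : Graph n) {x y : Fin n} (xy : Adj G x y) {m : ℕ}
  (f : Colouring (Minus2 x y) m) (f-proper : Proper G (Minus2 x y) f) (f-irrelevant : Irrelevant f)
  where

  HasColour? : ∀ u a → Dec (HasColour f u a)
  HasColour? u a with Minus2? x y u
  ... | no u∉ = no (u∉ ∘ proj₁)
  ... | yes p with f u p ≟ a
  ...   | yes fu≡a = yes (p , fu≡a)
  ...   | no fu≢a = no λ (q , fu≡a) → fu≢a (trans (f-irrelevant u p q) fu≡a)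

  -- Walk cs v: a walk v, v₁, …, v_k, y in which v_t has colour cs (t - 1).
  data Walk : ∀ {k} → (Fin k → Fin m) → Fin n → Set where
    end  : ∀ {cs : Fin 0 → Fin m} {v} → Adj G v y → Walk cs v
    step : ∀ {k} {cs : Fin (suc k) → Fin m} {v} u →
           Adj G v u → HasColour f u (head cs) → Walk (tail cs) u → Walk cs v

  Walk? : ∀ {k} (cs : Fin k → Fin m) v → Dec (Walk cs v)
  Walk? {zero}  cs v = map′ end (λ { (end vy) → vy }) (T? (adj G v y))
  Walk? {suc k} cs v =
    map′ (λ (u , vu , cu , w) → step u vu cu w) (λ { (step u vu cu w) → u , vu , cu , w })
         (any? λ u → T? (adj G v u) ×-dec HasColour? u (head cs) ×-dec Walk? (tail cs) u)

  walkPath : ∀ {k} {cs : Fin k → Fin m} {v} → Walk cs v → Vec (Fin n) (suc (suc k))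
  walkTail : ∀ {k} {cs : Fin k → Fin m} {v} → Walk cs v → Vec (Fin n) (suc k)

  walkPath {v = v} w = v ∷ walkTail w

  walkTail (end _)        = y ∷ []
  walkTail (step _ _ _ w) = walkPath w

  walkPath-last : ∀ {k} {cs : Fin k → Fin m} {v} (w : Walk cs v) →
                  lookup (walkPath w) (fromℕ (suc k)) ≡ y
  walkPath-last (end _)        = refl
  walkPath-last (step _ _ _ w) = walkPath-last w

  walkPath-adjacent : ∀ {k} {cs : Fin k → Fin m} {v} (w : Walk cs v) (t : Fin (suc k)) →
                      Adj G (lookup (walkPath w) (inject₁ t)) (lookup (walkPath w) (suc t))
  walkPath-adjacent (end vy)       zero    = vy
  walkPath-adjacent (step _ vu _ _) zero    = vu
  walkPath-adjacent (step _ _ _ w)  (suc t) = walkPath-adjacent w t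

  walkPath-coloured : ∀ {k} {cs : Fin k → Fin m} {v} (w : Walk cs v) →
                      ColouredAs f k (walkPath w) cs
  walkPath-coloured (step _ _ cu _) zero    = cu
  walkPath-coloured (step _ _ _ w)  (suc t) = walkPath-coloured w t

  Avoids : ∀ {k} → Fin n → (Fin k → Fin m) → Set
  Avoids v cs = v ≢ y × (∀ t → ¬ HasColour f v (cs t))

  Avoids-tail : ∀ {k v} {cs : Fin (suc k) → Fin m} → Avoids v cs → Avoids v (tail cs)
  Avoids-tail (v≢y , v∉cs) = v≢y , v∉cs ∘ suc

  ∉walkPath : ∀ {k} {cs : Fin k → Fin m} {u v} → Avoids v cs → v ≢ u → (w : Walk cs u) →
              ∀ t → v ≢ lookup (walkPath w) t
  ∉walkPath _         v≢u _               zero       = v≢u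
  ∉walkPath (v≢y , _) _   (end _)         (suc zero) = v≢y
  ∉walkPath v-avoids  _   (step u _ cu w) (suc t)    = ∉walkPath (Avoids-tail v-avoids) v≢u w t
    where
    v≢u : _ ≢ u
    v≢u refl = proj₂ v-avoids zero cu

  walkPath-injective : ∀ {k} {cs : Fin k → Fin m} {v} → Injective _≡_ _≡_ cs → Avoids v cs →
                       (w : Walk cs v) → InjectiveVec (walkPath w)
  walkPath-injective _ (v≢y , _) (end _) =
    lookup-∷-injective (λ { zero → v≢y ; (suc ()) }) (lookup-∷-injective (λ ()) λ { {()} })
  walkPath-injective {cs = cs} cs-inj v-avoids (step u _ cu w) =
    lookup-∷-injective (∉walkPath (Avoids-tail v-avoids) v≢u w)
                       (walkPath-injective (suc-injective ∘ cs-inj) u-avoids w)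
    where
    v≢u : _ ≢ u
    v≢u refl = proj₂ v-avoids zero cu
    u-avoids : Avoids u (tail cs)
    u-avoids = proj₂ (proj₁ cu) , λ t cu′ → 0≢1+n (cs-inj (HasColour-unique f-irrelevant cu cu′))

  Layer : ∀ {k} → (Fin k → Fin m) → Fin k → Fin n → Set
  Layer cs zero    v = HasColour f v (head cs) × Walk (tail cs) v
  Layer cs (suc t) v = Layer (tail cs) t v

  Layer? : ∀ {k} (cs : Fin k → Fin m) t v → Dec (Layer cs t v)
  Layer? cs zero    v = HasColour? v (head cs) ×-dec Walk? (tail cs) v
  Layer? cs (suc t) v = Layer? (tail cs) t v

  Layer-coloured : ∀ {k} (cs : Fin k → Fin m) t {v} → Layer cs t v → HasColour f v (cs t)
  Layer-coloured cs zero    = proj₁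
  Layer-coloured cs (suc t) = Layer-coloured (tail cs) t

  Layer-last : ∀ {k} (cs : Fin (suc k) → Fin m) {v} →
               HasColour f v (cs (fromℕ k)) → Adj G v y → Layer cs (fromℕ k) v
  Layer-last {zero}  cs cv vy = cv , end vy
  Layer-last {suc k} cs cv vy = Layer-last (tail cs) cv vy

  Layer-step : ∀ {k} (cs : Fin (suc k) → Fin m) t {u v} →
               Layer cs (suc t) u → Adj G v u → HasColour f v (cs (inject₁ t)) →
               Layer cs (inject₁ t) v
  Layer-step cs zero    (cu , w) vu cv = cv , step _ vu cu w
  Layer-step cs (suc t) layer    vu cv = Layer-step (tail cs) t layer vu cv

  module Recolouring {r : ℕ} (cs : Fin (suc r) → Fin m) (cs-inj : Injective _≡_ _≡_ cs)
                     (no-walk : ¬ Walk cs x) where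

    new : Fin (suc m)
    new = fromℕ m

    new≢inject₁ : ∀ {a} → new ≢ inject₁ a
    new≢inject₁ = fromℕ≢inject₁

    shifted : Fin (suc r) → Fin (suc m)
    shifted zero    = new
    shifted (suc t) = inject₁ (cs (inject₁ t))

    shifted-injective : Injective _≡_ _≡_ shifted
    shifted-injective {zero}  {zero}  _ = refl
    shifted-injective {zero}  {suc _} e = contradiction e new≢inject₁
    shifted-injective {suc _} {zero}  e = contradiction (sym e) new≢inject₁
    shifted-injective {suc _} {suc _} e = cong suc (inject₁-injective (cs-inj (inject₁-injective e)))

    shifted≢last : ∀ t → shifted t ≢ inject₁ (cs (fromℕ r))
    shifted≢last zero    = new≢inject₁
    shifted≢last (suc t) = fromℕ≢inject₁ ∘ sym ∘ cs-inj ∘ inject₁-injective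

    data Kind : Fin n → Set where
      is-x      : Kind x
      is-y      : Kind y
      layered   : ∀ {v} t → Layer cs t v → Kind v
      unlayered : ∀ {v} → Minus2 x y v → (∀ t → ¬ Layer cs t v) → Kind v

    kind : ∀ v → Kind v
    kind v with v ≟ x | v ≟ y | any? (λ t → Layer? cs t v)
    ... | yes refl | _        | _             = is-x
    ... | no _     | yes refl | _             = is-y
    ... | no _     | no _     | yes (t , L)   = layered t L
    ... | no v≢x   | no v≢y   | no ∄layer     = unlayered (v≢x , v≢y) (λ t L → ∄layer (t , L))

    recolour : ∀ {v} → Kind v → Fin (suc m)
    recolour is-x                = new
    recolour is-y                = inject₁ (cs (fromℕ r))
    recolour (layered t _)       = shifted t
    recolour (unlayered {v} p _) = inject₁ (f v p)

    x-layered : ∀ t {v} → Layer cs t v → Adj G x v → new ≢ shifted t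
    x-layered zero    (cv , w) xv _ = no-walk (step _ xv cv w)
    x-layered (suc t) _        _    = new≢inject₁

    y-unlayered : ∀ {v} (p : Minus2 x y v) → (∀ t → ¬ Layer cs t v) → Adj G y v →
                  inject₁ (cs (fromℕ r)) ≢ inject₁ (f v p)
    y-unlayered p ∄layer yv e =
      ∄layer (fromℕ r) (Layer-last cs (p , sym (inject₁-injective e)) (Adj-sym G yv))

    layered-layered : ∀ t s {u v} → Layer cs t u → Layer cs s v → Adj G u v →
                      shifted t ≢ shifted s
    layered-layered t s Lu Lv uv e with shifted-injective {t} {s} e
    ... | refl =
      HasColour-proper {G = G} f-proper (Layer-coloured cs t Lu) (Layer-coloured cs t Lv) uv

    layered-unlayered : ∀ t {u v} (p : Minus2 x y v) → (∀ s → ¬ Layer cs s v) →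
                        Layer cs t u → Adj G u v → shifted t ≢ inject₁ (f v p)
    layered-unlayered zero    p ∄layer Lu uv = new≢inject₁
    layered-unlayered (suc t) p ∄layer Lu uv e =
      ∄layer (inject₁ t) (Layer-step cs t Lu (Adj-sym G uv) (p , sym (inject₁-injective e)))

    recolour-proper : ∀ {u v} (a : Kind u) (b : Kind v) → Adj G u v → recolour a ≢ recolour b
    recolour-proper is-x            is-x            xx = contradiction xx (Adj-irrefl G)
    recolour-proper is-x            is-y            _  = new≢inject₁
    recolour-proper is-x            (layered t L)   xv = x-layered t L xv
    recolour-proper is-x            (unlayered _ _) _  = new≢inject₁
    recolour-proper is-y            is-x            _  = new≢inject₁ ∘ sym
    recolour-proper is-y            is-y            yy = contradiction yy (Adj-irrefl G)
    recolour-proper is-y            (layered t _)   _  = shifted≢last t ∘ sym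
    recolour-proper is-y            (unlayered p U) yv = y-unlayered p U yv
    recolour-proper (layered t L)   is-x            vx = x-layered t L (Adj-sym G vx) ∘ sym
    recolour-proper (layered t _)   is-y            _  = shifted≢last t
    recolour-proper (layered t L)   (layered s L′)  uv = layered-layered t s L L′ uv
    recolour-proper (layered t L)   (unlayered p U) uv = layered-unlayered t p U L uv
    recolour-proper (unlayered _ _) is-x            _  = new≢inject₁ ∘ sym
    recolour-proper (unlayered p U) is-y            vy = y-unlayered p U (Adj-sym G vy) ∘ sym
    recolour-proper (unlayered p U) (layered t L)   vu =
      layered-unlayered t p U L (Adj-sym G vu) ∘ sym
    recolour-proper (unlayered p _) (unlayered q _) uv = f-proper _ _ p q uv ∘ inject₁-injective

    colourable : Colourable G All′ (suc m)
    colourable = (λ v _ → recolour (kind v)) , λ u v _ _ → recolour-proper (kind u) (kind v)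

  walk-from-x : ¬ Colourable G All′ (suc m) → ∀ {r} (cs : Fin (suc r) → Fin m) →
                Injective _≡_ _≡_ cs → Walk cs x
  walk-from-x uncolourable cs cs-inj with Walk? cs x
  ... | yes w       = w
  ... | no no-walk = contradiction (Recolouring.colourable cs cs-inj no-walk) uncolourable

  walkPath-isXYPath : ∀ {k} {cs : Fin k → Fin m} → Injective _≡_ _≡_ cs →
                      (w : Walk cs x) → IsXYPath G x y k (walkPath w)
  walkPath-isXYPath cs-inj w =
      walkPath-injective cs-inj (Adj⇒≢ G xy , λ _ (p , _) → proj₁ p refl) w
    , refl
    , walkPath-last w
    , walkPath-adjacent w

  walkPath-colours : ∀ {k} {cs cs′ : Fin k → Fin m} {v} (w : Walk cs v) (w′ : Walk cs′ v) →
                     walkPath w ≡ walkPath w′ → ∀ t → cs t ≡ cs′ t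
  walkPath-colours {k} {cs} {cs′} w w′ e =
    ColouredAs-injective {p = walkPath w} f-irrelevant (walkPath-coloured w)
      (subst (λ p → ColouredAs f k p cs′) (sym e) (walkPath-coloured w′))

module ColouredPaths {n : ℕ} (G : Graph n) {x y : Fin n} (xy : Adj G x y) {m : ℕ}
  (f : Colouring (Minus2 x y) m) (f-proper : Proper G (Minus2 x y) f)
  (uncolourable : Fin m → ¬ Colourable G All′ (suc m))
  where

  open Canonical (Minus2? x y) f
  open ColouredWalks G xy canonical (canonical-proper {G = G} f-proper) canonical-irrelevant

  walk : ∀ {r} (cs : Fin (suc r) → Fin m) → Injective _≡_ _≡_ cs → Walk cs x
  walk cs = walk-from-x (uncolourable (cs zero)) cs

  colouredPath : ∀ {r} (cs : Fin (suc r) → Fin m) → Injective _≡_ _≡_ cs →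
                 Σ (Vec (Fin n) (2 + suc r)) λ p →
                   IsXYPath G x y (suc r) p × ColouredAs f (suc r) p cs
  colouredPath cs cs-inj =
    walkPath w , walkPath-isXYPath cs-inj w , canonical-HasColour ∘ walkPath-coloured w
    where
    w : Walk cs x
    w = walk cs cs-inj

  colouredPaths : ∀ r → Σ (List (Vec (Fin n) (2 + suc r))) λ ps →
                  All (IsXYPath G x y (suc r)) ps × Unique ps × m P suc r ≤ length ps
  colouredPaths r =
      map path (toList injective)
    , All.map⁺ (universal path-isXYPath (toList injective))
    , Unique-map-toList path path-injective injective (arrangements-unique m (suc r))
    , (begin
        m P suc r                             ≤⟨ nPk≤nP′k m (suc r) ⟩
        m P′ suc r                            ≡⟨ length-arrangements m (suc r) ⟨
        length (arrangements m (suc r))       ≡⟨ length-map-toList path injective ⟨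
        length (map path (toList injective))  ∎)
    where
    open ≤-Reasoning

    injective : All InjectiveVec (arrangements m (suc r))
    injective = arrangements-injective m (suc r)

    path : ∃ InjectiveVec → Vec (Fin n) (2 + suc r)
    path (s , s-inj) = walkPath (walk (lookup s) s-inj)

    path-isXYPath : ∀ a → IsXYPath G x y (suc r) (path a)
    path-isXYPath (s , s-inj) = walkPath-isXYPath s-inj (walk (lookup s) s-inj)

    path-injective : ∀ {a b} → path a ≡ path b → proj₁ a ≡ proj₁ b
    path-injective {s , s-inj} {t , t-inj} e =
      lookup-extensionality (walkPath-colours (walk (lookup s) s-inj) (walk (lookup t) t-inj) e)

proposition4 : (k n : ℕ) (G : Graph n) →
    ¬ Complete G → KChromatic G k → DoubleCritical G k →
    (∀ (x y : Fin n) → Adj G x y →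
       (f : Colouring (Minus2 x y) (k ∸ 2)) → Proper G (Minus2 x y) f →
       (i : ℕ) → 1 ≤ i → (js : Fin i → Fin (k ∸ 2)) → Injective _≡_ _≡_ js →
       Σ (Vec (Fin n) (2 Data.Nat.+ i)) (λ p → IsXYPath G x y i p × ColouredAs f i p js))
    ×
    (∀ (x y : Fin n) → Adj G x y → (i : ℕ) → 1 ≤ i →
       Σ (List (Vec (Fin n) (2 Data.Nat.+ i)))
         (λ ps → All (IsXYPath G x y i) ps × Unique ps × (k ∸ 2) P i ≤ length ps))
proposition4 k n G _ χ≡k (_ , edge-critical) =
    (λ { x y xy f f-proper (suc r) _ → ColouredPaths.colouredPath G xy f f-proper uncolourable })
  , (λ { x y xy (suc r) _ →
         let f , f-proper = ChiAtMost⇒Colourable {G = G} (edge-critical x y xy)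
         in  ColouredPaths.colouredPaths G xy f f-proper uncolourable r })
  where
  uncolourable : Fin (k ∸ 2) → ¬ Colourable G All′ (suc (k ∸ 2))
  uncolourable = KChromatic⇒¬Colourable[1+k∸2] {G = G} χ≡k
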